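{- Let $d$ be a positive integer, let $G=(V,E)$ be a finite graph and let $f_E:E\to\mathbb{Z}_d$ be an e-labeling of $G$. Then $(G,f_E)$ is additive if and only if it is compatible.
   Context: $\mathbb{Z}_d$ denotes the integers modulo $d$. An e-labeling is a map $f_E:E\to\mathbb{Z}_d$ and a v-labeling is a map $f_V:V\to\mathbb{Z}_d$. A v-labeling $f_V$ is a valid v-labeling of $(G,f_E)$ if $f_E((v,v'))\equiv f_V(v)+f_V(v') \pmod d$ for every edge $(v,v')\in E$; $(G,f_E)$ (or $f_E$) is called additive if a valid v-labeling exists. A cycle of length $k$ is a closed walk, not necessarily simple: vertices $v_1,\dots,v_k$ (repetitions allowed) and edges $e_1,\dots,e_k$ with $e_i=(v_i,v_{i+1})$ for $i<k$ and $e_k=(v_k,v_1)$ (edges may repeat). $(G,f_E)$ has the even cycle property if every cycle of even length, with edges $e_1,\dots,e_{2k}$, satisfies $\sum_{l\text{ odd}} f_E(e_l)\equiv\sum_{l\text{ even}} f_E(e_l)\pmod d$. For $d$ even, $(G,f_E)$ has the odd cycle property if every cycle of odd length, with edges $e_1,\dots,e_{2k+1}$, satisfies $\frac d2\sum_{l=1}^{2k+1} f_E(e_l)\equiv 0\pmod d$ (equivalently, the sum of the labels, taken as integers in $\{0,\dots,d-1\}$, is even). $(G,f_E)$ is compatible if either $d$ is odd and $(G,f_E)$ has the even cycle property, or $d$ is even and $(G,f_E)$ has both the even and the odd cycle properties. -}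

module Defs where

open import Data.Nat using (ℕ; zero; suc; _+_; _*_; _%_; _/_; NonZero)
open import Data.Nat.Divisibility using (_∣_)
open import Data.Fin using (Fin; toℕ; fromℕ; inject₁; zero; suc)
open import Data.Bool using (if_then_else_)
open import Data.Nat using (_≡ᵇ_)
open import Data.Product using (_×_; _,_; Σ; ∃)
open import Data.Sum using (_⊎_)
open import Relation.Nullary using (¬_)
open import Relation.Binary.PropositionalEquality using (_≡_)

-- A finite graph: vertices Fin n, edges Fin m, each edge e has an
-- (unordered) pair of endpoints, given as  ends e.  Multiple edges and
-- loops are permitted.
record Graph : Set where
  field
    nV   : ℕ
    nE   : ℕ
    ends : Fin nE → Fin nV × Fin nV
open Graph public

-- Z_d is Fin d; congruence modulo d on ℕ.
infix 4 _≡[mod_]_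
_≡[mod_]_ : ℕ → (d : ℕ) → .{{NonZero d}} → ℕ → Set
a ≡[mod d ] b = a % d ≡ b % d

Joins : (G : Graph) → Fin (nE G) → Fin (nV G) → Fin (nV G) → Set
Joins G e u w = ends G e ≡ (u , w) ⊎ ends G e ≡ (w , u)

-- A cycle (closed walk) of length k: vertices v_0..v_k with v_k = v_0,
-- edges e_0..e_{k-1}, e_i joining v_i and v_{i+1}.
IsCycle : (G : Graph) (k : ℕ) → (Fin (suc k) → Fin (nV G)) → (Fin k → Fin (nE G)) → Set
IsCycle G k vs es =
  (vs (fromℕ k) ≡ vs zero) × (∀ i → Joins G (es i) (vs (inject₁ i)) (vs (suc i)))

sumFin : (k : ℕ) → (Fin k → ℕ) → ℕ
sumFin zero    f = 0
sumFin (suc k) f = f zero + sumFin k (λ i → f (suc i))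

-- 0-indexed position i is the 1-indexed position i+1
isOddPos : ∀ {k} → Fin k → Data.Bool.Bool
isOddPos i = toℕ i % 2 ≡ᵇ 0

oddPosSum : (k : ℕ) → (Fin k → ℕ) → ℕ
oddPosSum k f = sumFin k (λ i → if isOddPos i then f i else 0)

evenPosSum : (k : ℕ) → (Fin k → ℕ) → ℕ
evenPosSum k f = sumFin k (λ i → if isOddPos i then 0 else f i)

module _ (d : ℕ) .{{_ : NonZero d}} (G : Graph) (fE : Fin (nE G) → Fin d) where

  ValidVLabeling : (Fin (nV G) → Fin d) → Set
  ValidVLabeling fV =
    ∀ e → toℕ (fE e) ≡[mod d ] (toℕ (fV (Data.Product.proj₁ (ends G e)))
                                 + toℕ (fV (Data.Product.proj₂ (ends G e))))

  Additive : Set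
  Additive = Σ (Fin (nV G) → Fin d) ValidVLabeling

  EvenCycleProperty : Set
  EvenCycleProperty =
    ∀ (j : ℕ) (vs : Fin (suc (2 * j)) → Fin (nV G)) (es : Fin (2 * j) → Fin (nE G)) →
    IsCycle G (2 * j) vs es →
    oddPosSum (2 * j) (λ i → toℕ (fE (es i)))
      ≡[mod d ] evenPosSum (2 * j) (λ i → toℕ (fE (es i)))

  OddCycleProperty : Set
  OddCycleProperty =
    ∀ (j : ℕ) (vs : Fin (suc (suc (2 * j))) → Fin (nV G)) (es : Fin (suc (2 * j)) → Fin (nE G)) →
    IsCycle G (suc (2 * j)) vs es →
    (d / 2) * sumFin (suc (2 * j)) (λ i → toℕ (fE (es i))) ≡[mod d ] 0

  Compatible : Set
  Compatible = (¬ (2 ∣ d) × EvenCycleProperty) ⊎ ((2 ∣ d) × EvenCycleProperty × OddCycleProperty)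

module Submission where

-- Everything is governed by the alternating sum  alt p = ℓ(e₁) − ℓ(e₂) + ⋯
-- of the labels along a walk p, computed in ℤ and compared modulo d.
-- Write σ_p x for x or −x according as p has even or odd length.
--
-- * A potential (an integer vertex labelling F with ℓ(e) ≡ F u + F w on
--   every edge) satisfies F u ≡ alt p + σ_p (F w) along every walk p from u
--   to w; hence every closed walk q at r obeys the closed-walk law
--   alt q ≡ F r − σ_q (F r), i.e. alt q ≡ 0 if q is even and ≡ 2 F r if q
--   is odd.  The first gives the even cycle property, the second the odd
--   one, since Σ ℓ(eᵢ) and alt q differ by an even integer.
-- * Conversely, if some x : V → ℤ obeys the closed-walk law, choose for
--   each vertex a root of its connected component and a walk p to it; then
--   F v = alt p + σ_p (x root) does not depend on p and is a potential.
--   Compatibility yields such an x: even closed walks have alt ≡ 0, and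
--   for odd closed walks alt is a double (2 is invertible if d is odd; for
--   d = 2h the odd cycle property h·Σ ≡ 0 forces Σ, hence alt, to be even).
--
-- Choosing roots needs decidable reachability, obtained from the fact that
-- a walk can be shortened, keeping its ends and parity, to one of length
-- < 2|V| (pigeonhole in the double cover V × Bool).

open import Defs
open import Data.Nat using (ℕ; NonZero)
open import Data.Fin using (Fin)
open import Data.Product using (_×_)

import Data.Nat as ℕ
import Data.Nat.Properties as ℕₚ
open import Data.Nat.DivMod using (m≡m%n+[m/n]*n; [m+kn]%n≡m%n; m%n<n; m*n/n≡m)
open import Data.Nat.Divisibility using (_∣_; _∣?_; divides; m%n≡0⇒n∣m)
open import Data.Fin using (zero; suc; toℕ; fromℕ; fromℕ<; inject₁; join; splitAt)
open import Data.Fin.Properties using (any?; pigeonhole; splitAt-join; toℕ-fromℕ<; <-irrefl)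
  renaming (_≟_ to _≟ᶠ_)
open import Data.Integer using (ℤ; +_; -_; _+_; _-_; _*_; 0ℤ; 1ℤ; -1ℤ; -[1+_])
open import Data.Integer.Properties
  using (pos-+; pos-*; +-injective; *-cancelˡ-≡; +-identityˡ; +-inverseʳ; +-comm; neg-involutive)
open import Data.Integer.DivMod using (_/ℕ_; n%ℕd<d; a≡a%ℕn+[a/ℕn]*n)
open import Data.Integer.Tactic.RingSolver using (solve-∀)
open import Data.Bool using (Bool; true; false; not; _xor_; if_then_else_; T)
open import Data.Bool.Properties using (not-involutive; not-injective; not-distribˡ-xor; not-distribʳ-xor; xor-same)
  renaming (_≟_ to _≟ᵇ_)
open import Data.Maybe using (Maybe; just; nothing)
import Data.Maybe as Maybe
open import Data.Maybe.Properties using (just-injective)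
open import Data.Product using (Σ; ∃; ∃-syntax; _,_; proj₁; proj₂)
import Data.Product.Properties as Productₚ
open import Data.Sum using (_⊎_; inj₁; inj₂; [_,_])
open import Data.Unit using (⊤; tt)
open import Data.Empty using (⊥-elim)
open import Function using (_∘_)
open import Function.Bundles using (mk⇔)
open import Relation.Nullary using (¬_; Dec; yes; no)
open import Relation.Nullary.Decidable
  using (isYes; isYes≗does; does-⇔; map′; toWitness; fromWitness; _×-dec_; _⊎-dec_)
open import Relation.Binary.PropositionalEquality
  using (_≡_; refl; sym; trans; cong; cong₂; subst; subst₂; module ≡-Reasoning)
open ≡-Reasoning

par : ℕ → Bool
par ℕ.zero    = false
par (ℕ.suc n) = not (par n)

par-+ : ∀ m n → par (m ℕ.+ n) ≡ par m xor par n
par-+ ℕ.zero    n = refl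
par-+ (ℕ.suc m) n = trans (cong not (par-+ m n)) (not-distribˡ-xor (par m) (par n))

par-double : ∀ j → par (2 ℕ.* j) ≡ false
par-double j = begin
  par (j ℕ.+ (j ℕ.+ 0))  ≡⟨ cong (λ m → par (j ℕ.+ m)) (ℕₚ.+-identityʳ j) ⟩
  par (j ℕ.+ j)          ≡⟨ par-+ j j ⟩
  par j xor par j        ≡⟨ xor-same (par j) ⟩
  false                  ∎

par-even : ∀ k → par k ≡ false → ∃[ j ] k ≡ 2 ℕ.* j
par-odd  : ∀ k → par k ≡ true  → ∃[ j ] k ≡ ℕ.suc (2 ℕ.* j)
par-even ℕ.zero    _ = 0 , refl
par-even (ℕ.suc k) e with par-odd k (not-injective {y = true} e)
... | j , refl = ℕ.suc j , cong ℕ.suc (sym (ℕₚ.+-suc j (j ℕ.+ 0)))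
par-odd ℕ.zero    ()
par-odd (ℕ.suc k) e with par-even k (not-injective {y = false} e)
... | j , refl = j , refl

sgn : Bool → ℤ → ℤ
sgn false z = z
sgn true  z = - z

sgn-sub : ∀ b c a x → c - (a + sgn b x) ≡ (c - a) + sgn (not b) x
sgn-sub false = identity
  where
  identity : ∀ c a x → c - (a + x) ≡ (c - a) + - x
  identity = solve-∀
sgn-sub true = identity
  where
  identity : ∀ c a x → c - (a + - x) ≡ (c - a) + x
  identity = solve-∀

sgn-cancel : ∀ b c a x → (c - a + sgn (not b) x) + (a + sgn b x) ≡ c
sgn-cancel false = identity
  where
  identity : ∀ c a x → (c - a + - x) + (a + x) ≡ c
  identity = solve-∀
sgn-cancel true = identity
  where
  identity : ∀ c a x → (c - a + x) + (a + - x) ≡ c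
  identity = solve-∀

-- The alternating sum of a reversed walk, one step at a time.
sgn-reverse : ∀ b a c → - sgn b a + sgn b (c - 0ℤ) ≡ - sgn (not b) (c - a)
sgn-reverse false = identity
  where
  identity : ∀ a c → - a + (c - 0ℤ) ≡ - - (c - a)
  identity = solve-∀
sgn-reverse true = identity
  where
  identity : ∀ a c → - - a + - (c - 0ℤ) ≡ - (c - a)
  identity = solve-∀

-- The four parity cases behind path independence: the difference of
-- a₁ + σ₁x and a₂ + σ₂x is ±(the defect of −σ₁a₁ + σ₁a₂ from x − σ₁σ₂x).
sgn-switch : ∀ b c a₁ a₂ x →
  a₁ + sgn b x ≡ (a₂ + sgn c x) + sgn b 1ℤ * ((x - sgn (b xor c) x) - (- sgn b a₁ + sgn b a₂))
sgn-switch false false = identity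
  where
  identity : ∀ a₁ a₂ x → a₁ + x ≡ (a₂ + x) + 1ℤ * ((x - x) - (- a₁ + a₂))
  identity = solve-∀
sgn-switch false true = identity
  where
  identity : ∀ a₁ a₂ x → a₁ + x ≡ (a₂ + - x) + 1ℤ * ((x - - x) - (- a₁ + a₂))
  identity = solve-∀
sgn-switch true false = identity
  where
  identity : ∀ a₁ a₂ x → a₁ + - x ≡ (a₂ + x) + -1ℤ * ((x - - x) - (- - a₁ + - a₂))
  identity = solve-∀
sgn-switch true true = identity
  where
  identity : ∀ a₁ a₂ x → a₁ + - x ≡ (a₂ + - x) + -1ℤ * ((x - x) - (- - a₁ + - a₂))
  identity = solve-∀

sumFin-cong : ∀ k {f g : Fin k → ℕ} → (∀ i → f i ≡ g i) → sumFin k f ≡ sumFin k g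
sumFin-cong ℕ.zero    _  = refl
sumFin-cong (ℕ.suc k) eq = cong₂ ℕ._+_ (eq zero) (sumFin-cong k (eq ∘ suc))

isOddPos-suc : ∀ {k} (i : Fin k) → isOddPos (suc i) ≡ not (isOddPos i)
isOddPos-suc i = %2-suc (toℕ i)
  where
  %2-suc : ∀ n → (ℕ.suc n ℕ.% 2 ℕ.≡ᵇ 0) ≡ not (n ℕ.% 2 ℕ.≡ᵇ 0)
  %2-suc 0 = refl
  %2-suc 1 = refl
  %2-suc (ℕ.suc (ℕ.suc n)) = %2-suc n

if-not : ∀ {A : Set} b (x y : A) → (if not b then x else y) ≡ (if b then y else x)
if-not true  x y = refl
if-not false x y = refl

oddPosSum-suc : ∀ k (f : Fin (ℕ.suc k) → ℕ) →
  oddPosSum (ℕ.suc k) f ≡ f zero ℕ.+ evenPosSum k (f ∘ suc)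
oddPosSum-suc k f = cong (f zero ℕ.+_) (sumFin-cong k λ i →
  trans (cong (λ b → if b then f (suc i) else 0) (isOddPos-suc i)) (if-not (isOddPos i) _ _))

evenPosSum-suc : ∀ k (f : Fin (ℕ.suc k) → ℕ) →
  evenPosSum (ℕ.suc k) f ≡ oddPosSum k (f ∘ suc)
evenPosSum-suc k f = sumFin-cong k λ i →
  trans (cong (λ b → if b then 0 else f (suc i)) (isOddPos-suc i)) (if-not (isOddPos i) _ _)

altSum : ∀ k → (Fin k → ℕ) → ℤ
altSum ℕ.zero    f = 0ℤ
altSum (ℕ.suc k) f = + f zero - altSum k (f ∘ suc)

odd-even≡altSum : ∀ k f → + oddPosSum k f - + evenPosSum k f ≡ altSum k f
odd-even≡altSum ℕ.zero    f = refl
odd-even≡altSum (ℕ.suc k) f = begin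
  + oddPosSum (ℕ.suc k) f - + evenPosSum (ℕ.suc k) f
    ≡⟨ cong₂ (λ o e → + o - + e) (oddPosSum-suc k f) (evenPosSum-suc k f) ⟩
  + (f zero ℕ.+ E) - + O
    ≡⟨ cong (_- + O) (pos-+ (f zero) E) ⟩
  + f zero + + E - + O
    ≡⟨ regroup (+ f zero) (+ E) (+ O) ⟩
  + f zero - (+ O - + E)
    ≡⟨ cong (λ z → + f zero - z) (odd-even≡altSum k (f ∘ suc)) ⟩
  altSum (ℕ.suc k) f ∎
  where
  O : ℕ
  O = oddPosSum k (f ∘ suc)
  E : ℕ
  E = evenPosSum k (f ∘ suc)
  regroup : ∀ a b c → a + b - c ≡ a - (c - b)
  regroup = solve-∀

sum≡altSum+even : ∀ k f → ∃[ t ] + sumFin k f ≡ altSum k f + (t + t)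
sum≡altSum+even ℕ.zero    f = 0ℤ , refl
sum≡altSum+even (ℕ.suc k) f with sum≡altSum+even k (f ∘ suc)
... | t , eq = A + t , (begin
  + (f zero ℕ.+ sumFin k (f ∘ suc))  ≡⟨ pos-+ (f zero) _ ⟩
  + f zero + + sumFin k (f ∘ suc)    ≡⟨ cong (λ z → + f zero + z) eq ⟩
  + f zero + (A + (t + t))           ≡⟨ regroup (+ f zero) A t ⟩
  + f zero - A + ((A + t) + (A + t)) ∎)
  where
  A : ℤ
  A = altSum k (f ∘ suc)
  regroup : ∀ a b t → a + (b + (t + t)) ≡ a - b + ((b + t) + (b + t))
  regroup = solve-∀

module Congruence (d : ℕ) .{{_ : NonZero d}} where

  D : ℤ
  D = + d

  infix 4 _≈_
  data _≈_ (x y : ℤ) : Set where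
    _,_ : (q : ℤ) → x ≡ y + q * D → x ≈ y

  ≈-refl : ∀ {x} → x ≈ x
  ≈-refl {x} = 0ℤ , identity x D
    where
    identity : ∀ x D → x ≡ x + 0ℤ * D
    identity = solve-∀

  ≡⇒≈ : ∀ {x y} → x ≡ y → x ≈ y
  ≡⇒≈ refl = ≈-refl

  ≈-sym : ∀ {x y} → x ≈ y → y ≈ x
  ≈-sym {y = y} (q , refl) = - q , identity y q D
    where
    identity : ∀ y q D → y ≡ (y + q * D) + - q * D
    identity = solve-∀

  ≈-trans : ∀ {x y z} → x ≈ y → y ≈ z → x ≈ z
  ≈-trans {z = z} (p , refl) (q , refl) = q + p , identity z p q D
    where
    identity : ∀ z p q D → z + q * D + p * D ≡ z + (q + p) * D
    identity = solve-∀

  ≈-+ : ∀ {x y u v} → x ≈ y → u ≈ v → x + u ≈ y + v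
  ≈-+ {y = y} {v = v} (p , refl) (q , refl) = p + q , identity y v p q D
    where
    identity : ∀ y v p q D → y + p * D + (v + q * D) ≡ y + v + (p + q) * D
    identity = solve-∀

  ≈-neg : ∀ {x y} → x ≈ y → - x ≈ - y
  ≈-neg {y = y} (q , refl) = - q , identity y q D
    where
    identity : ∀ y q D → - (y + q * D) ≡ - y + - q * D
    identity = solve-∀

  ≈⇒diff≈0 : ∀ {x y} → x ≈ y → x - y ≈ 0ℤ
  ≈⇒diff≈0 {y = y} (q , refl) = q , identity y q D
    where
    identity : ∀ y q D → y + q * D - y ≡ 0ℤ + q * D
    identity = solve-∀

  ≈-by : ∀ {X Y Z} k → Z ≈ 0ℤ → X ≡ Y + k * Z → X ≈ Y
  ≈-by {Y = Y} k (q , refl) refl = k * q , identity Y k q D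
    where
    identity : ∀ Y k q D → Y + k * (0ℤ + q * D) ≡ Y + k * q * D
    identity = solve-∀

  divMod : ∀ a → + a ≡ + (a ℕ.% d) + + (a ℕ./ d) * D
  divMod a = begin
    + a                                    ≡⟨ cong +_ (m≡m%n+[m/n]*n a d) ⟩
    + (a ℕ.% d ℕ.+ a ℕ./ d ℕ.* d)          ≡⟨ pos-+ (a ℕ.% d) _ ⟩
    + (a ℕ.% d) + + (a ℕ./ d ℕ.* d)        ≡⟨ cong (λ z → + (a ℕ.% d) + z) (pos-* (a ℕ./ d) d) ⟩
    + (a ℕ.% d) + + (a ℕ./ d) * D          ∎

  %≡⇒≈ : ∀ {a b} → a ≡[mod d ] b → + a ≈ + b
  %≡⇒≈ {a} {b} eq = + (a ℕ./ d) - + (b ℕ./ d) , (begin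
    + a                                    ≡⟨ divMod a ⟩
    + (a ℕ.% d) + + (a ℕ./ d) * D          ≡⟨ cong (λ r → + r + + (a ℕ./ d) * D) eq ⟩
    + (b ℕ.% d) + + (a ℕ./ d) * D          ≡⟨ shift (+ (b ℕ.% d)) (+ (a ℕ./ d)) (+ (b ℕ./ d)) D ⟩
    + (b ℕ.% d) + + (b ℕ./ d) * D + (+ (a ℕ./ d) - + (b ℕ./ d)) * D
      ≡⟨ cong (_+ (+ (a ℕ./ d) - + (b ℕ./ d)) * D) (sym (divMod b)) ⟩
    + b + (+ (a ℕ./ d) - + (b ℕ./ d)) * D  ∎)
    where
    shift : ∀ r p q D → r + p * D ≡ r + q * D + (p - q) * D
    shift = solve-∀

  ≈⇒%≡ : ∀ {a b} → + a ≈ + b → a ≡[mod d ] b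
  ≈⇒%≡ {a} {b} (+ n , eq) = plus-multiple n eq
    where
    plus-multiple : ∀ {a b} n → + a ≡ + b + + n * D → a ≡[mod d ] b
    plus-multiple {a} {b} n eq = begin
      a ℕ.% d                  ≡⟨ cong (ℕ._% d) (+-injective (trans eq (sym as-ℕ))) ⟩
      (b ℕ.+ n ℕ.* d) ℕ.% d    ≡⟨ [m+kn]%n≡m%n b n d ⟩
      b ℕ.% d                  ∎
      where
      as-ℕ : + (b ℕ.+ n ℕ.* d) ≡ + b + + n * D
      as-ℕ = trans (pos-+ b (n ℕ.* d)) (cong (λ z → + b + z) (pos-* n d))
  ≈⇒%≡ {a} {b} (-[1+ n ] , eq) = sym (≈⇒%≡ (+ ℕ.suc n , trans (undo (+ b) -[1+ n ] D) (cong (_+ + ℕ.suc n * D) (sym eq))))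
    where
    undo : ∀ y q D → y ≡ (y + q * D) + - q * D
    undo = solve-∀

  reduce : ℤ → Fin d
  reduce z = fromℕ< (n%ℕd<d z d)

  reduce-≈ : ∀ z → + toℕ (reduce z) ≈ z
  reduce-≈ z rewrite toℕ-fromℕ< (n%ℕd<d z d) = ≈-sym (z /ℕ d , a≡a%ℕn+[a/ℕn]*n z d)

  even-modulus : ∀ {h} → d ≡ h ℕ.* 2 → D ≡ + h + + h
  even-modulus {h} d≡2h = begin
    + d              ≡⟨ cong +_ (trans d≡2h (ℕₚ.*-comm h 2)) ⟩
    + (h ℕ.+ (h ℕ.+ 0)) ≡⟨ cong (λ m → + (h ℕ.+ m)) (ℕₚ.+-identityʳ h) ⟩
    + (h ℕ.+ h)      ≡⟨ pos-+ h h ⟩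
    + h + + h        ∎

  -- For d = 2h: h kills every integer that is a double modulo d up to an
  -- even correction (this is how the odd cycle property arises).
  half-kills-doubles : ∀ {h} → d ≡ h ℕ.* 2 → ∀ {S A x t} → S ≡ A + (t + t) → A ≈ x + x → + h * S ≈ 0ℤ
  half-kills-doubles {h} d≡2h {x = x} {t} refl (q , refl) = x + t + + h * q , (begin
    + h * (x + x + q * D + (t + t))
      ≡⟨ cong (λ D′ → + h * (x + x + q * D′ + (t + t))) (even-modulus {h} d≡2h) ⟩
    + h * (x + x + q * (+ h + + h) + (t + t))
      ≡⟨ identity (+ h) x q t ⟩
    0ℤ + (x + t + + h * q) * (+ h + + h)
      ≡⟨ cong (λ D′ → 0ℤ + (x + t + + h * q) * D′) (sym (even-modulus {h} d≡2h)) ⟩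
    0ℤ + (x + t + + h * q) * D ∎)
    where
    identity : ∀ h x q t → h * (x + x + q * (h + h) + (t + t)) ≡ 0ℤ + (x + t + h * q) * (h + h)
    identity = solve-∀

  half-annihilated⇒even : ∀ {h} → d ≡ h ℕ.* 2 → ∀ S → + h * S ≈ 0ℤ → ∃[ s ] S ≡ s + s
  half-annihilated⇒even {ℕ.zero}  d≡0 S _ = ⊥-elim (ℕ.≢-nonZero⁻¹ d d≡0)
  half-annihilated⇒even {ℕ.suc h} d≡2h S (q , eq) = q , *-cancelˡ-≡ H S (q + q) (begin
    H * S               ≡⟨ eq ⟩
    0ℤ + q * D          ≡⟨ cong (λ D′ → 0ℤ + q * D′) (even-modulus {ℕ.suc h} d≡2h) ⟩
    0ℤ + q * (H + H)    ≡⟨ identity H q ⟩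
    H * (q + q)         ∎)
    where
    H : ℤ
    H = + ℕ.suc h
    identity : ∀ H q → 0ℤ + q * (H + H) ≡ H * (q + q)
    identity = solve-∀

  doubles-of-half-killed : ∀ {h} → d ≡ h ℕ.* 2 → ∀ {S A t} → S ≡ A + (t + t) → + h * S ≈ 0ℤ → ∃[ x ] A ≈ x + x
  doubles-of-half-killed {h} d≡2h {A = A} {t} refl killed with half-annihilated⇒even {h} d≡2h (A + (t + t)) killed
  ... | s , even = s - t , ≡⇒≈ (begin
    A                       ≡⟨ identity A t ⟩
    A + (t + t) - (t + t)   ≡⟨ cong (_- (t + t)) even ⟩
    s + s - (t + t)         ≡⟨ identity′ s t ⟩
    (s - t) + (s - t)       ∎)
    where
    identity : ∀ A t → A ≡ A + (t + t) - (t + t)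
    identity = solve-∀
    identity′ : ∀ s t → s + s - (t + t) ≡ (s - t) + (s - t)
    identity′ = solve-∀

  -- For odd d, 2 is invertible: every integer is a double modulo d.
  odd-modulus-halves : ¬ (2 ∣ d) → ∀ a → ∃[ x ] a ≈ x + x
  odd-modulus-halves 2∤d a = (1ℤ + H) * a , - a , (begin
    a                                  ≡⟨ identity H a ⟩
    (1ℤ + H) * a + (1ℤ + H) * a + - a * (1ℤ + (H + H))
      ≡⟨ cong (λ D′ → (1ℤ + H) * a + (1ℤ + H) * a + - a * D′) (sym odd-form) ⟩
    (1ℤ + H) * a + (1ℤ + H) * a + - a * D ∎)
    where
    h : ℕ
    h = d ℕ./ 2
    H : ℤ
    H = + h
    identity : ∀ H a → a ≡ (1ℤ + H) * a + (1ℤ + H) * a + - a * (1ℤ + (H + H))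
    identity = solve-∀
    remainder-one : d ℕ.% 2 ≡ 1
    remainder-one with d ℕ.% 2 in eq | m%n<n d 2
    ... | 0 | _ = ⊥-elim (2∤d (m%n≡0⇒n∣m d 2 eq))
    ... | 1 | _ = refl
    ... | ℕ.suc (ℕ.suc _) | ℕ.s≤s (ℕ.s≤s ())
    odd-form : D ≡ 1ℤ + (H + H)
    odd-form = begin
      + d                         ≡⟨ cong +_ (m≡m%n+[m/n]*n d 2) ⟩
      + (d ℕ.% 2 ℕ.+ h ℕ.* 2)     ≡⟨ cong (λ r → + (r ℕ.+ h ℕ.* 2)) remainder-one ⟩
      + (1 ℕ.+ h ℕ.* 2)           ≡⟨ pos-+ 1 (h ℕ.* 2) ⟩
      1ℤ + + (h ℕ.* 2)            ≡⟨ cong (λ z → 1ℤ + z) (pos-* h 2) ⟩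
      1ℤ + H * + 2                ≡⟨ cong (λ z → 1ℤ + z) (double H) ⟩
      1ℤ + (H + H)                ∎
      where
      double : ∀ H → H * + 2 ≡ H + H
      double = solve-∀

module Walks (G : Graph) where

  V : Set
  V = Fin (nV G)

  E : Set
  E = Fin (nE G)

  Step : V → V → Set
  Step u v = Σ E λ e → Joins G e u v

  step-sym : ∀ {u v} → Step u v → Step v u
  step-sym (e , j) = e , joins-sym j
    where
    joins-sym : ∀ {e u v} → Joins G e u v → Joins G e v u
    joins-sym (inj₁ eq) = inj₂ eq
    joins-sym (inj₂ eq) = inj₁ eq

  infixr 5 _∷_ _++_
  data Walk : V → V → Set where
    []  : ∀ {v} → Walk v v
    _∷_ : ∀ {u v w} → Step u v → Walk v w → Walk u w

  len : ∀ {u w} → Walk u w → ℕ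
  len []      = 0
  len (_ ∷ p) = ℕ.suc (len p)

  isOdd : ∀ {u w} → Walk u w → Bool
  isOdd p = par (len p)

  _++_ : ∀ {u v w} → Walk u v → Walk v w → Walk u w
  []      ++ q = q
  (s ∷ p) ++ q = s ∷ (p ++ q)

  rev : ∀ {u w} → Walk u w → Walk w u
  rev []      = []
  rev (s ∷ p) = rev p ++ (step-sym s ∷ [])

  isOdd-++ : ∀ {u v w} (p : Walk u v) (q : Walk v w) → isOdd (p ++ q) ≡ isOdd p xor isOdd q
  isOdd-++ []      q = refl
  isOdd-++ (s ∷ p) q = trans (cong not (isOdd-++ p q)) (not-distribˡ-xor (isOdd p) (isOdd q))

  isOdd-rev : ∀ {u w} (p : Walk u w) → isOdd (rev p) ≡ isOdd p
  isOdd-rev []      = refl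
  isOdd-rev (s ∷ p) = begin
    isOdd (rev p ++ (step-sym s ∷ []))  ≡⟨ isOdd-++ (rev p) (step-sym s ∷ []) ⟩
    isOdd (rev p) xor true             ≡⟨ cong (_xor true) (isOdd-rev p) ⟩
    isOdd p xor true                   ≡⟨ flip (isOdd p) ⟩
    not (isOdd p)                      ∎
    where
    flip : ∀ b → b xor true ≡ not b
    flip false = refl
    flip true  = refl

  vertexAt : ∀ {u w} (p : Walk u w) → Fin (ℕ.suc (len p)) → V
  vertexAt {u} p       zero    = u
  vertexAt     (_ ∷ p) (suc i) = vertexAt p i

  edgeAt : ∀ {u w} (p : Walk u w) → Fin (len p) → E
  edgeAt ((e , _) ∷ p) zero    = e
  edgeAt (_ ∷ p)       (suc i) = edgeAt p i

  edgeAt-joins : ∀ {u w} (p : Walk u w) i →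
    Joins G (edgeAt p i) (vertexAt p (inject₁ i)) (vertexAt p (suc i))
  edgeAt-joins ((_ , j) ∷ p) zero    = j
  edgeAt-joins (_ ∷ p)       (suc i) = edgeAt-joins p i

  vertexAt-last : ∀ {u w} (p : Walk u w) → vertexAt p (fromℕ (len p)) ≡ w
  vertexAt-last []      = refl
  vertexAt-last (_ ∷ p) = vertexAt-last p

  walkAlong : ∀ k (vs : Fin (ℕ.suc k) → V) (es : Fin k → E) →
    (∀ i → Joins G (es i) (vs (inject₁ i)) (vs (suc i))) → Walk (vs zero) (vs (fromℕ k))
  walkAlong ℕ.zero    vs es joins = []
  walkAlong (ℕ.suc k) vs es joins = (es zero , joins zero) ∷ walkAlong k (vs ∘ suc) (es ∘ suc) (joins ∘ suc)

  len-walkAlong : ∀ k vs es joins → len (walkAlong k vs es joins) ≡ k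
  len-walkAlong ℕ.zero    vs es joins = refl
  len-walkAlong (ℕ.suc k) vs es joins = cong ℕ.suc (len-walkAlong k (vs ∘ suc) (es ∘ suc) (joins ∘ suc))

  -- Visits p x b: p is at x after a number of steps of parity b, i.e. p
  -- passes through the point (x , b) of the double cover V × Bool.  Loops
  -- are cut out of walks at such repeated visits.
  data Visits : ∀ {u w} → Walk u w → V → Bool → Set where
    here  : ∀ {u w} {p : Walk u w} → Visits p u false
    there : ∀ {u v w x b} {s : Step u v} {p : Walk v w} → Visits p x (not b) → Visits (s ∷ p) x b

  visits? : ∀ {u w} (p : Walk u w) x b → Dec (Visits p x b)
  visits? {u} [] x b with x ≟ᶠ u | b
  ... | yes refl | false = yes here
  ... | yes refl | true  = no λ ()
  ... | no x≢u   | _     = no λ { here → x≢u refl }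
  visits? {u} (s ∷ p) x b with x ≟ᶠ u | b | visits? p x (not b)
  ... | yes refl | false | _        = yes here
  ... | _        | _     | yes v    = yes (there v)
  ... | yes refl | true  | no ¬v    = no λ { (there v) → ¬v v }
  ... | no x≢u   | _     | no ¬v    = no λ { here → x≢u refl ; (there v) → ¬v v }

  suffix : ∀ {u w x b} {p : Walk u w} → Visits p x b → Σ (Walk x w) λ q → isOdd q ≡ b xor isOdd p
  suffix {p = p} here = p , refl
  suffix {b = b} {p = s ∷ p} (there v) =
    proj₁ (suffix v) , trans (proj₂ (suffix v)) (trans (sym (not-distribˡ-xor b (isOdd p))) (not-distribʳ-xor b (isOdd p)))

  -- A walk is simple when it never revisits a point of the double cover.
  Simple : ∀ {u w} → Walk u w → Set
  Simple []              = ⊤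
  Simple (_∷_ {u} _ p)   = ¬ Visits p u true × Simple p

  suffix-simple : ∀ {u w x b} {p : Walk u w} → Simple p → (v : Visits p x b) → Simple (proj₁ (suffix v))
  suffix-simple simple          here      = simple
  suffix-simple (_ , simple)    (there v) = suffix-simple simple v

  shorten : ∀ {u w} (p : Walk u w) → Σ (Walk u w) λ q → isOdd q ≡ isOdd p × Simple q
  shorten [] = [] , refl , tt
  shorten (_∷_ {u} s p) with shorten p
  ... | q , same , simple with visits? q u true
  ...   | yes v  = proj₁ (suffix v) , trans (proj₂ (suffix v)) (cong not same) , suffix-simple simple v
  ...   | no ¬v  = s ∷ q , cong not same , ¬v , simple

  at : ∀ {u w} (p : Walk u w) → Fin (ℕ.suc (len p)) → V × Bool
  at p i = vertexAt p i , par (toℕ i)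

  visits-at : ∀ {u w} (p : Walk u w) i → Visits p (vertexAt p i) (par (toℕ i))
  visits-at p       zero    = here
  visits-at (s ∷ p) (suc i) = there (subst (Visits p (vertexAt p i)) (sym (not-involutive _)) (visits-at p i))

  at-injective : ∀ {u w} (p : Walk u w) → Simple p → ∀ i j → at p i ≡ at p j → i ≡ j
  at-injective []      _            zero    zero    _  = refl
  at-injective (s ∷ p) _            zero    zero    _  = refl
  at-injective (s ∷ p) (¬v , _)     zero    (suc j) eq =
    ⊥-elim (¬v (subst₂ (Visits p) (sym (cong proj₁ eq)) (not-injective {y = true} (sym (cong proj₂ eq))) (visits-at p j)))
  at-injective (s ∷ p) simple       (suc i) zero    eq = sym (at-injective (s ∷ p) simple zero (suc i) (sym eq))
  at-injective (s ∷ p) (_ , simple) (suc i) (suc j) eq =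
    cong suc (at-injective p simple i j (cong₂ _,_ (cong proj₁ eq) (not-injective (cong proj₂ eq))))

  encode : V × Bool → Fin (nV G ℕ.+ nV G)
  encode (v , b) = join (nV G) (nV G) (if b then inj₂ v else inj₁ v)

  encode-injective : ∀ a c → encode a ≡ encode c → a ≡ c
  encode-injective (v , b) (w , c) eq = tagged b c (begin
    (if b then inj₂ v else inj₁ v)                         ≡⟨ sym (splitAt-join (nV G) (nV G) _) ⟩
    splitAt (nV G) (encode (v , b))                         ≡⟨ cong (splitAt (nV G)) eq ⟩
    splitAt (nV G) (encode (w , c))                         ≡⟨ splitAt-join (nV G) (nV G) _ ⟩
    (if c then inj₂ w else inj₁ w)                         ∎)
    where
    tagged : ∀ b c → (if b then inj₂ v else inj₁ v) ≡ (if c then inj₂ w else inj₁ w) → (v , b) ≡ (w , c)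
    tagged false false refl = refl
    tagged true  true  refl = refl
    tagged false true  ()
    tagged true  false ()

  -- Pigeonhole: a simple walk has fewer than 2|V| steps.
  simple-short : ∀ {u w} (p : Walk u w) → Simple p → len p ℕ.< nV G ℕ.+ nV G
  simple-short p simple with ℕ.suc (len p) ℕₚ.≤? nV G ℕ.+ nV G
  ... | yes short = short
  ... | no long with pigeonhole (ℕₚ.≰⇒> long) (encode ∘ at p)
  ...   | i , j , i<j , same = ⊥-elim (<-irrefl (at-injective p simple i j (encode-injective _ _ same)) i<j)

  WalkOfLength : V → V → ℕ → Set
  WalkOfLength u w k = Σ (Walk u w) λ p → len p ≡ k

  joins? : ∀ e u v → Dec (Joins G e u v)
  joins? e u v = ≡-pair? (ends G e) (u , v) ⊎-dec ≡-pair? (ends G e) (v , u)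
    where
    ≡-pair? : (a c : V × V) → Dec (a ≡ c)
    ≡-pair? = Productₚ.≡-dec _≟ᶠ_ _≟ᶠ_

  walkOfLength? : ∀ k u w → Dec (WalkOfLength u w k)
  walkOfLength? ℕ.zero u w with u ≟ᶠ w
  ... | yes refl = yes ([] , refl)
  ... | no u≢w   = no λ { ([] , _) → u≢w refl ; (_ ∷ _ , ()) }
  walkOfLength? (ℕ.suc k) u w =
    map′ extend split (any? λ v → any? (λ e → joins? e u v) ×-dec walkOfLength? k v w)
    where
    extend : ∃ (λ v → Step u v × WalkOfLength v w k) → WalkOfLength u w (ℕ.suc k)
    extend (_ , s , p , refl) = s ∷ p , refl
    split : WalkOfLength u w (ℕ.suc k) → ∃ (λ v → Step u v × WalkOfLength v w k)
    split (s ∷ p , refl) = _ , s , p , refl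

  -- Reach u w b: there is a walk from u to w of parity b.  This is
  -- decidable, since only lengths below 2|V| need to be tried.
  Reach : V → V → Bool → Set
  Reach u w b = Σ (Walk u w) λ p → isOdd p ≡ b

  reach? : ∀ u w b → Dec (Reach u w b)
  reach? u w b = map′ found bounded
    (any? λ (i : Fin (nV G ℕ.+ nV G)) → walkOfLength? (toℕ i) u w ×-dec (par (toℕ i) ≟ᵇ b))
    where
    found : ∃ (λ i → WalkOfLength u w (toℕ i) × par (toℕ i) ≡ b) → Reach u w b
    found (_ , (p , length) , odd) = p , trans (cong par length) odd
    bounded : Reach u w b → ∃ (λ i → WalkOfLength u w (toℕ i) × par (toℕ i) ≡ b)
    bounded (p , odd) with shorten p
    ... | q , same , simple =
      fromℕ< short , (q , sym length) , trans (cong par length) (trans same odd)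
      where
      short : len q ℕ.< nV G ℕ.+ nV G
      short = simple-short q simple
      length : toℕ (fromℕ< short) ≡ len q
      length = toℕ-fromℕ< short

  connected? : ∀ u w → Dec (Walk u w)
  connected? u w = map′ [ proj₁ , proj₁ ] by-parity (reach? u w false ⊎-dec reach? u w true)
    where
    by-parity : Walk u w → Reach u w false ⊎ Reach u w true
    by-parity p with isOdd p in odd
    ... | false = inj₁ (p , odd)
    ... | true  = inj₂ (p , odd)

  first : ∀ {m} → (Fin m → Bool) → Maybe (Fin m)
  first {ℕ.zero}  P = nothing
  first {ℕ.suc m} P = if P zero then just zero else Maybe.map suc (first (P ∘ suc))

  first-cong : ∀ {m} {P Q : Fin m → Bool} → (∀ i → P i ≡ Q i) → first P ≡ first Q
  first-cong {ℕ.zero}  eq = refl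
  first-cong {ℕ.suc m} eq =
    cong₂ (λ b r → if b then just zero else Maybe.map suc r) (eq zero) (first-cong (eq ∘ suc))

  first-succeeds : ∀ {m} (P : Fin m → Bool) i → T (P i) → ∃[ j ] first P ≡ just j × T (P j)
  first-succeeds {ℕ.suc m} P i Pi with P zero in P₀
  ... | true = zero , refl , subst T (sym P₀) tt
  first-succeeds P zero    Pi | false = ⊥-elim (subst T P₀ Pi)
  first-succeeds P (suc i) Pi | false with first-succeeds (P ∘ suc) i Pi
  ... | j , found , Pj = suc j , cong (Maybe.map suc) found , Pj

  private
    connectedTo : V → V → Bool
    connectedTo v r = isYes (connected? v r)

    rootSpec : ∀ v → ∃[ r ] first (connectedTo v) ≡ just r × T (connectedTo v r)
    rootSpec v = first-succeeds (connectedTo v) v (fromWitness {a? = connected? v v} [])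

  root : V → V
  root v = proj₁ (rootSpec v)

  toRoot : ∀ v → Walk v (root v)
  toRoot v = toWitness {a? = connected? v (root v)} (proj₂ (proj₂ (rootSpec v)))

  root-step : ∀ {u v} → Step u v → root u ≡ root v
  root-step {u} {v} s = just-injective (begin
    just (root u)          ≡⟨ sym (proj₁ (proj₂ (rootSpec u))) ⟩
    first (connectedTo u)  ≡⟨ first-cong same-component ⟩
    first (connectedTo v)  ≡⟨ proj₁ (proj₂ (rootSpec v)) ⟩
    just (root v)          ∎)
    where
    same-component : ∀ r → connectedTo u r ≡ connectedTo v r
    same-component r = trans (isYes≗does (connected? u r))
      (trans (does-⇔ (mk⇔ (step-sym s ∷_) (s ∷_)) (connected? u r) (connected? v r))
             (sym (isYes≗does (connected? v r))))

module Potentials (d : ℕ) .{{_ : NonZero d}} (G : Graph) (ℓ : Fin (nE G) → ℕ) where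
  open Congruence d
  open Walks G

  alt : ∀ {u w} → Walk u w → ℤ
  alt []            = 0ℤ
  alt ((e , _) ∷ p) = + ℓ e - alt p

  alt-++ : ∀ {u v w} (p : Walk u v) (q : Walk v w) → alt (p ++ q) ≡ alt p + sgn (isOdd p) (alt q)
  alt-++ []            q = sym (+-identityˡ (alt q))
  alt-++ ((e , _) ∷ p) q = begin
    + ℓ e - alt (p ++ q)                         ≡⟨ cong (λ z → + ℓ e - z) (alt-++ p q) ⟩
    + ℓ e - (alt p + sgn (isOdd p) (alt q))      ≡⟨ sgn-sub (isOdd p) (+ ℓ e) (alt p) (alt q) ⟩
    + ℓ e - alt p + sgn (not (isOdd p)) (alt q)  ∎

  alt-rev : ∀ {u w} (p : Walk u w) → alt (rev p) ≡ - sgn (isOdd p) (alt p)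
  alt-rev []                = refl
  alt-rev (s@(e , _) ∷ p) = begin
    alt (rev p ++ (step-sym s ∷ []))
      ≡⟨ alt-++ (rev p) (step-sym s ∷ []) ⟩
    alt (rev p) + sgn (isOdd (rev p)) (+ ℓ e - 0ℤ)
      ≡⟨ cong₂ (λ a b → a + sgn b (+ ℓ e - 0ℤ)) (alt-rev p) (isOdd-rev p) ⟩
    - sgn (isOdd p) (alt p) + sgn (isOdd p) (+ ℓ e - 0ℤ)
      ≡⟨ sgn-reverse (isOdd p) (alt p) (+ ℓ e) ⟩
    - sgn (not (isOdd p)) (+ ℓ e - alt p) ∎

  alt-walkAlong : ∀ k vs es joins → alt (walkAlong k vs es joins) ≡ altSum k (ℓ ∘ es)
  alt-walkAlong ℕ.zero    vs es joins = refl
  alt-walkAlong (ℕ.suc k) vs es joins =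
    cong (λ z → + ℓ (es zero) - z) (alt-walkAlong k (vs ∘ suc) (es ∘ suc) (joins ∘ suc))

  altSum-edgeAt : ∀ {u w} (p : Walk u w) → altSum (len p) (ℓ ∘ edgeAt p) ≡ alt p
  altSum-edgeAt []            = refl
  altSum-edgeAt ((e , _) ∷ p) = cong (λ z → + ℓ e - z) (altSum-edgeAt p)

  cycle→walk : ∀ k vs es → IsCycle G k vs es →
    Σ (Walk (vs zero) (vs zero)) λ q → len q ≡ k × alt q ≡ altSum k (ℓ ∘ es)
  cycle→walk k vs es (closed , joins) =
    close closed (walkAlong k vs es joins) (len-walkAlong k vs es joins) (alt-walkAlong k vs es joins)
    where
    close : ∀ {w} → w ≡ vs zero → (p : Walk (vs zero) w) → len p ≡ k → alt p ≡ altSum k (ℓ ∘ es) →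
      Σ (Walk (vs zero) (vs zero)) λ q → len q ≡ k × alt q ≡ altSum k (ℓ ∘ es)
    close refl p length alternating = p , length , alternating

  walk→cycle : ∀ {r} (q : Walk r r) {k} → len q ≡ k →
    Σ (Fin (ℕ.suc k) → V) λ vs → Σ (Fin k → E) λ es → IsCycle G k vs es × altSum k (ℓ ∘ es) ≡ alt q
  walk→cycle q refl = vertexAt q , edgeAt q , (vertexAt-last q , edgeAt-joins q) , altSum-edgeAt q

  IsPotential : (V → ℤ) → Set
  IsPotential F = ∀ e → + ℓ e ≈ F (proj₁ (ends G e)) + F (proj₂ (ends G e))

  ClosedWalkLaw : (V → ℤ) → Set
  ClosedWalkLaw x = ∀ {r} (q : Walk r r) → alt q ≈ x r - sgn (isOdd q) (x r)

  potential-joins : ∀ F → IsPotential F → ∀ {e u v} → Joins G e u v → + ℓ e ≈ F u + F v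
  potential-joins F pot {e} (inj₁ eq) = subst (λ ends → + ℓ e ≈ F (proj₁ ends) + F (proj₂ ends)) eq (pot e)
  potential-joins F pot {e} {u} {v} (inj₂ eq) =
    ≈-trans (subst (λ ends → + ℓ e ≈ F (proj₁ ends) + F (proj₂ ends)) eq (pot e)) (≡⇒≈ (+-comm (F v) (F u)))

  potential-walk : ∀ F → IsPotential F → ∀ {u w} (p : Walk u w) → F u ≈ alt p + sgn (isOdd p) (F w)
  potential-walk F pot {u} [] = ≡⇒≈ (sym (+-identityˡ (F u)))
  potential-walk F pot {u} {w} (_∷_ {v = v} (e , j) p) =
    ≈-trans step (≈-trans (≈-+ (≈-refl {+ ℓ e}) (≈-neg (potential-walk F pot p)))
                          (≡⇒≈ (sgn-sub (isOdd p) (+ ℓ e) (alt p) (F w))))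
    where
    step : F u ≈ + ℓ e - F v
    step = ≈-by 1ℤ (≈⇒diff≈0 (≈-sym (potential-joins F pot j))) (identity (F u) (F v) (+ ℓ e))
      where
      identity : ∀ a b c → a ≡ (c - b) + 1ℤ * (a + b - c)
      identity = solve-∀

  potential-law : ∀ F → IsPotential F → ClosedWalkLaw F
  potential-law F pot {r} q =
    ≈-by -1ℤ (≈⇒diff≈0 (potential-walk F pot q)) (identity (alt q) (F r) (sgn (isOdd q) (F r)))
    where
    identity : ∀ a f s → a ≡ (f - s) + -1ℤ * (f - (a + s))
    identity = solve-∀

  EvenWalkLaw : Set
  EvenWalkLaw = ∀ {r} (q : Walk r r) → isOdd q ≡ false → alt q ≈ 0ℤ

  OddWalksHalvable : Set
  OddWalksHalvable = ∀ {r} (q : Walk r r) → isOdd q ≡ true → ∃[ x ] alt q ≈ x + x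

  -- They combine into a closed-walk law: x r is half the alternating sum
  -- of some odd closed walk at r (if there is one), and every other odd
  -- closed walk at r agrees with it by the even law.
  closed-walk-law : EvenWalkLaw → OddWalksHalvable → ∃ ClosedWalkLaw
  closed-walk-law even halvable = x , law
    where
    x : V → ℤ
    x r with reach? r r true
    ... | yes (q , odd) = proj₁ (halvable q odd)
    ... | no _          = 0ℤ

    odd-walks-agree : ∀ {r} (q q′ : Walk r r) → isOdd q ≡ true → isOdd q′ ≡ true → alt q ≈ alt q′
    odd-walks-agree q q′ odd odd′ =
      ≈-by 1ℤ (subst (_≈ 0ℤ) alt-loop (even (q ++ rev q′) even-loop)) (identity (alt q) (alt q′))
      where
      identity : ∀ a b → a ≡ b + 1ℤ * (a - b)
      identity = solve-∀
      even-loop : isOdd (q ++ rev q′) ≡ false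
      even-loop = trans (isOdd-++ q (rev q′)) (cong₂ _xor_ odd (trans (isOdd-rev q′) odd′))
      alt-loop : alt (q ++ rev q′) ≡ alt q - alt q′
      alt-loop = begin
        alt (q ++ rev q′)                               ≡⟨ alt-++ q (rev q′) ⟩
        alt q + sgn (isOdd q) (alt (rev q′))            ≡⟨ cong₂ (λ b z → alt q + sgn b z) odd (alt-rev q′) ⟩
        alt q + - - sgn (isOdd q′) (alt q′)             ≡⟨ cong (λ b → alt q + - - sgn b (alt q′)) odd′ ⟩
        alt q + - - - alt q′                            ≡⟨ cong (λ z → alt q + z) (neg-involutive (- alt q′)) ⟩
        alt q - alt q′                                  ∎

    law : ClosedWalkLaw x
    law {r} q with isOdd q in odd
    ... | false = ≈-trans (even q odd) (≡⇒≈ (sym (+-inverseʳ (x r))))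
    ... | true with reach? r r true
    ...   | yes (q₀ , odd₀) = ≈-trans (odd-walks-agree q q₀ odd odd₀)
                                 (≈-trans (proj₂ (halvable q₀ odd₀)) (≡⇒≈ (cong (λ z → x₀ + z) (sym (neg-involutive x₀)))))
      where
      x₀ : ℤ
      x₀ = proj₁ (halvable q₀ odd₀)
    ...   | no none = ⊥-elim (none (q , odd))

  -- Conversely, a closed-walk law yields a potential: propagate x back
  -- from the root of each component.  The closed-walk law applied to
  -- rev p₁ ++ p₂ shows that the propagated value does not depend on the walk.
  module _ (x : V → ℤ) (law : ClosedWalkLaw x) where

    value : ∀ {v r} → Walk v r → ℤ
    value {r = r} p = alt p + sgn (isOdd p) (x r)

    value-independent : ∀ {v r} (p₁ p₂ : Walk v r) → value p₁ ≈ value p₂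
    value-independent {r = r} p₁ p₂ =
      ≈-by (sgn b₁ 1ℤ) (≈⇒diff≈0 (≈-sym loop)) (sgn-switch b₁ b₂ (alt p₁) (alt p₂) (x r))
      where
      b₁ : Bool
      b₁ = isOdd p₁
      b₂ : Bool
      b₂ = isOdd p₂
      alt-loop : alt (rev p₁ ++ p₂) ≡ - sgn b₁ (alt p₁) + sgn b₁ (alt p₂)
      alt-loop = trans (alt-++ (rev p₁) p₂) (cong₂ (λ a b → a + sgn b (alt p₂)) (alt-rev p₁) (isOdd-rev p₁))
      odd-loop : isOdd (rev p₁ ++ p₂) ≡ b₁ xor b₂
      odd-loop = trans (isOdd-++ (rev p₁) p₂) (cong (_xor b₂) (isOdd-rev p₁))
      loop : - sgn b₁ (alt p₁) + sgn b₁ (alt p₂) ≈ x r - sgn (b₁ xor b₂) (x r)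
      loop = subst₂ (λ a b → a ≈ x r - sgn b (x r)) alt-loop odd-loop (law (rev p₁ ++ p₂))

    propagated : V → ℤ
    propagated v = value (toRoot v)

    potential-from-law : IsPotential propagated
    potential-from-law e = ≈-sym (edge (root-step (e , inj₁ refl)) (e , inj₁ refl) (toRoot _) (toRoot _))
      where
      -- For an edge a — b and walks to a common root, compare the walk
      -- from a with the one through b.
      edge : ∀ {a b r r′} → r ≡ r′ → (s : Step a b) (pa : Walk a r) (pb : Walk b r′) →
        value pa + value pb ≈ + ℓ (proj₁ s)
      edge {r = r} refl (e , j) pa pb =
        ≈-trans (≈-+ (value-independent pa ((e , j) ∷ pb)) (≈-refl {value pb}))
                (≡⇒≈ (sgn-cancel (isOdd pb) (+ ℓ e) (alt pb) (x r)))

module Labelling (d : ℕ) .{{_ : NonZero d}} (G : Graph) (fE : Fin (nE G) → Fin d) where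
  open Congruence d
  open Walks G
  open Potentials d G (toℕ ∘ fE)

  valid⇒potential : ∀ fV → ValidVLabeling d G fE fV → IsPotential (λ v → + toℕ (fV v))
  valid⇒potential fV valid e =
    ≈-trans (%≡⇒≈ (valid e)) (≡⇒≈ (pos-+ (toℕ (fV (proj₁ (ends G e)))) (toℕ (fV (proj₂ (ends G e))))))

  potential⇒additive : ∀ F → IsPotential F → Additive d G fE
  potential⇒additive F potential = reduce ∘ F , valid
    where
    valid : ValidVLabeling d G fE (reduce ∘ F)
    valid e = ≈⇒%≡ (≈-trans (potential e)
      (≈-trans (≈-+ (≈-sym (reduce-≈ (F a))) (≈-sym (reduce-≈ (F b)))) (≡⇒≈ (sym (pos-+ (toℕ (reduce (F a))) (toℕ (reduce (F b))))))))
      where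
      a : V
      a = proj₁ (ends G e)
      b : V
      b = proj₂ (ends G e)

  half-times : ∀ {h} → d ≡ h ℕ.* 2 → ∀ S → + (d ℕ./ 2 ℕ.* S) ≡ + h * + S
  half-times {h} d≡2h S = trans (cong (λ m → + (m ℕ.* S)) (trans (cong (ℕ._/ 2) d≡2h) (m*n/n≡m h 2))) (pos-* h S)

  law⇒even-cycles : ∀ x → ClosedWalkLaw x → EvenCycleProperty d G fE
  law⇒even-cycles x law j vs es cycle with cycle→walk (2 ℕ.* j) vs es cycle
  ... | q , length , alternating = ≈⇒%≡ (≈-by 1ℤ vanishes (identity (+ oddPosSum k ℓs) (+ evenPosSum k ℓs)))
    where
    k : ℕ
    k = 2 ℕ.* j
    ℓs : Fin k → ℕ
    ℓs = toℕ ∘ fE ∘ es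
    r : V
    r = vs zero
    identity : ∀ o e → o ≡ e + 1ℤ * (o - e)
    identity = solve-∀
    vanishes : + oddPosSum k ℓs - + evenPosSum k ℓs ≈ 0ℤ
    vanishes = subst (_≈ 0ℤ) (trans alternating (sym (odd-even≡altSum k ℓs)))
      (≈-trans (law q) (≡⇒≈ (trans (cong (λ b → x r - sgn b (x r)) (trans (cong par length) (par-double j)))
                                    (+-inverseʳ (x r)))))

  even-cycles⇒even-walks : EvenCycleProperty d G fE → EvenWalkLaw
  even-cycles⇒even-walks even-cycles q even with par-even (len q) even
  ... | j , length with walk→cycle q length
  ... | vs , es , cycle , alternating =
    subst (_≈ 0ℤ) (trans (odd-even≡altSum (2 ℕ.* j) (toℕ ∘ fE ∘ es)) alternating)
      (≈⇒diff≈0 (%≡⇒≈ (even-cycles j vs es cycle)))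

  -- For even d, the odd cycle property is the odd half of the
  -- closed-walk law: sums and alternating sums differ by even integers.
  law⇒odd-cycles : 2 ∣ d → ∀ x → ClosedWalkLaw x → OddCycleProperty d G fE
  law⇒odd-cycles (divides h d≡2h) x law j vs es cycle
    with cycle→walk (ℕ.suc (2 ℕ.* j)) vs es cycle | sum≡altSum+even (ℕ.suc (2 ℕ.* j)) (toℕ ∘ fE ∘ es)
  ... | q , length , alternating | t , sum-eq =
    ≈⇒%≡ (subst (_≈ 0ℤ) (sym (half-times {h} d≡2h _)) (half-kills-doubles {h} d≡2h {x = x r} {t} sum-eq double))
    where
    r : V
    r = vs zero
    double : altSum (ℕ.suc (2 ℕ.* j)) (toℕ ∘ fE ∘ es) ≈ x r + x r
    double = subst (_≈ x r + x r) alternating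
      (≈-trans (law q) (≡⇒≈ (trans (cong (λ b → x r - sgn b (x r)) (trans (cong par length) (cong not (par-double j))))
                                     (cong (λ z → x r + z) (neg-involutive (x r))))))

  odd-cycles⇒halvable : 2 ∣ d → OddCycleProperty d G fE → OddWalksHalvable
  odd-cycles⇒halvable (divides h d≡2h) odd-cycles q odd with par-odd (len q) odd
  ... | j , length with walk→cycle q length
  ... | vs , es , cycle , alternating with sum≡altSum+even (ℕ.suc (2 ℕ.* j)) (toℕ ∘ fE ∘ es)
  ... | t , sum-eq = subst (λ a → ∃[ y ] a ≈ y + y) alternating
    (doubles-of-half-killed {h} d≡2h {t = t} sum-eq
      (subst (_≈ 0ℤ) (half-times {h} d≡2h _) (%≡⇒≈ (odd-cycles j vs es cycle))))

  law⇒compatible : ∀ x → ClosedWalkLaw x → Compatible d G fE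
  law⇒compatible x law with 2 ∣? d
  ... | yes 2∣d = inj₂ (2∣d , law⇒even-cycles x law , law⇒odd-cycles 2∣d x law)
  ... | no  2∤d = inj₁ (2∤d , law⇒even-cycles x law)

  compatible⇒law : Compatible d G fE → ∃ ClosedWalkLaw
  compatible⇒law (inj₁ (2∤d , even-cycles)) =
    closed-walk-law (even-cycles⇒even-walks even-cycles) (λ q _ → odd-modulus-halves 2∤d (alt q))
  compatible⇒law (inj₂ (2∣d , even-cycles , odd-cycles)) =
    closed-walk-law (even-cycles⇒even-walks even-cycles) (odd-cycles⇒halvable 2∣d odd-cycles)

theorem1 : (d : ℕ) .{{_ : NonZero d}} (G : Graph) (fE : Fin (nE G) → Fin d) →
    (Additive d G fE → Compatible d G fE) × (Compatible d G fE → Additive d G fE)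
theorem1 d G fE = additive⇒compatible , compatible⇒additive
  where
  open Labelling d G fE
  open Potentials d G (toℕ ∘ fE)

  additive⇒compatible : Additive d G fE → Compatible d G fE
  additive⇒compatible (fV , valid) = law⇒compatible F (potential-law F (valid⇒potential fV valid))
    where
    F : Fin (nV G) → ℤ
    F = λ v → + toℕ (fV v)

  compatible⇒additive : Compatible d G fE → Additive d G fE
  compatible⇒additive compatible with compatible⇒law compatible
  ... | x , law = potential⇒additive (propagated x law) (potential-from-law x law)
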